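{- Let $k\geq 1$, $n\geq t\geq 1$, and let $u,v\in\Sigma_k^t$ be words such that $u\neq v$ and the pair $(u,v)$ is mutually unbordered. Let $G_{u,v}(m)$ denote the number of unbordered words of length $m$ over $\Sigma_k$ that have $u$ as a prefix and $v$ as a suffix. Then \[ G_{u,v}(n)=\begin{cases} 0, & \text{if } n<2t;\\ k^{n-2t}-\sum_{i=2t}^{\lfloor n/2\rfloor} G_{u,v}(i)\,k^{n-2i}, & \text{if } n\geq 2t.\end{cases}\]
   Context: $\Sigma_k=\{0,1,\ldots,k-1\}$ and $\Sigma_k^t$ is the set of length-$t$ words over $\Sigma_k$. A border of a word $w$ is a non-empty word that is both a proper prefix and a proper suffix of $w$; $w$ is unbordered if it has no border. For a pair of words $(u,v)$, a right-border is a non-empty word that is a proper suffix of $u$ and a proper prefix of $v$, and a left-border is a non-empty word that is a proper prefix of $u$ and a proper suffix of $v$; $(u,v)$ is mutually unbordered if it has neither a right-border nor a left-border. -}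

module Defs where

open import Data.Nat using (ℕ; zero; suc; _+_; _*_; _∸_; _^_; _≤_; _<_; _≤?_; _<?_; s≤s; z≤n)
open import Data.Nat.Properties using (≤-refl; m≤m+n; <-irrefl; anyUpTo?)
open import Data.Fin using (Fin)
open import Data.Fin.Properties using () renaming (_≟_ to _≟F_)
open import Data.List using (List; []; _∷_; _++_; length; take; drop; filter; map; concatMap; allFin; applyUpTo)
open import Data.Nat.ListAction using (sum)
open import Data.List.Properties using (≡-dec; length-++; take++drop≡id; length-take; length-drop)
open import Data.List.Relation.Unary.Any using (Any)
open import Data.List.Relation.Unary.Any.Properties using ()
open import Data.Product using (Σ; ∃; ∃-syntax; _×_; _,_; proj₁; proj₂)
open import Data.Empty using (⊥)
open import Relation.Nullary using (¬_; Dec; yes; no)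
open import Relation.Nullary.Decidable using (¬?)
open import Relation.Nullary.Decidable using (_×-dec_)
open import Relation.Binary.PropositionalEquality using (_≡_; _≢_; refl; sym; trans; cong; subst)

Word : ℕ → Set
Word k = List (Fin k)

words : (k t : ℕ) → List (Word k)
words k zero    = [] ∷ []
words k (suc t) = concatMap (λ a → map (a ∷_) (words k t)) (allFin k)

module _ {k : ℕ} where

  ProperPrefix : Word k → Word k → Set
  ProperPrefix p w = (∃[ s ] (p ++ s ≡ w)) × length p < length w

  ProperSuffix : Word k → Word k → Set
  ProperSuffix s w = (∃[ p ] (p ++ s ≡ w)) × length s < length w

  NonEmpty : Word k → Set
  NonEmpty b = b ≢ []

  Border : Word k → Word k → Set
  Border b w = NonEmpty b × ProperPrefix b w × ProperSuffix b w

  Unbordered : Word k → Set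
  Unbordered w = ∀ b → ¬ Border b w

  RightBorder : Word k → Word k → Word k → Set
  RightBorder b u v = NonEmpty b × ProperSuffix b u × ProperPrefix b v

  LeftBorder : Word k → Word k → Word k → Set
  LeftBorder b u v = NonEmpty b × ProperPrefix b u × ProperSuffix b v

  MutuallyUnbordered : Word k → Word k → Set
  MutuallyUnbordered u v = (∀ b → ¬ RightBorder b u v) × (∀ b → ¬ LeftBorder b u v)

  IsPrefix : Word k → Word k → Set
  IsPrefix p w = ∃[ s ] (p ++ s ≡ w)

  IsSuffix : Word k → Word k → Set
  IsSuffix s w = ∃[ p ] (p ++ s ≡ w)

  isPrefix? : ∀ p w → Dec (IsPrefix p w)
  isPrefix? p w with ≡-dec _≟F_ (take (length p) w) p
  ... | yes eq = yes (drop (length p) w , trans (cong (_++ drop (length p) w) (sym eq)) (take++drop≡id (length p) w))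
  ... | no neq = no λ { (s , refl) → neq (take-++ p s) }
    where
      take-++ : ∀ (p s : Word k) → take (length p) (p ++ s) ≡ p
      take-++ [] s = refl
      take-++ (x ∷ p) s = cong (x ∷_) (take-++ p s)

  isSuffix? : ∀ s w → Dec (IsSuffix s w)
  isSuffix? s w with ≡-dec _≟F_ (drop (length w ∸ length s) w) s
  ... | yes eq = yes (take (length w ∸ length s) w , trans (cong (take (length w ∸ length s) w ++_) (sym eq)) (take++drop≡id (length w ∸ length s) w))
  ... | no neq = no λ { (p , refl) → neq (drop-suf p s) }
    where
      drop-suf : ∀ (p s : Word k) → drop (length (p ++ s) ∸ length s) (p ++ s) ≡ s
      drop-suf [] s rewrite Data.Nat.Properties.n∸n≡0 (length s) = refl
      drop-suf (x ∷ p) s rewrite length-++ p {s} | Data.Nat.Properties.+-∸-assoc 1 (Data.Nat.Properties.m≤n+m (length s) (length p)) | sym (length-++ p {s}) = drop-suf p s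

  properPrefix? : ∀ p w → Dec (ProperPrefix p w)
  properPrefix? p w = isPrefix? p w ×-dec (length p <? length w)

  properSuffix? : ∀ s w → Dec (ProperSuffix s w)
  properSuffix? s w = isSuffix? s w ×-dec (length s <? length w)

  nonEmpty? : ∀ b → Dec (NonEmpty b)
  nonEmpty? [] = no λ ne → ne refl
  nonEmpty? (x ∷ b) = yes λ ()

  private
    prefix-take : ∀ {p w} → IsPrefix p w → take (length p) w ≡ p
    prefix-take {[]} _ = refl
    prefix-take {x ∷ p} (s , refl) = cong (x ∷_) (prefix-take {p} (s , refl))

  -- ∃ b. R b w, where every witness is a proper prefix of w, reduces to
  -- a search over the lengths of the prefixes of w.
  exists-prefix? : (R : Word k → Set) → (∀ b → Dec (R b)) → (w : Word k)
                 → (∀ {b} → R b → ProperPrefix b w) → Dec (∃[ b ] R b)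
  exists-prefix? R R? w toPre with anyUpTo? (λ ℓ → R? (take ℓ w)) (length w)
  ... | yes (ℓ , _ , r) = yes (take ℓ w , r)
  ... | no ¬e = no λ { (b , r) → ¬e (length b , proj₂ (toPre r) , subst R (sym (prefix-take (proj₁ (toPre r)))) r) }

  bordered? : ∀ w → Dec (∃[ b ] Border b w)
  bordered? w = exists-prefix? (λ b → Border b w) (λ b → nonEmpty? b ×-dec properPrefix? b w ×-dec properSuffix? b w) w (λ r → proj₁ (proj₂ r))

  unbordered? : ∀ w → Dec (Unbordered w)
  unbordered? w with bordered? w
  ... | yes (b , r) = no λ un → un b r
  ... | no ¬e = yes λ b r → ¬e (b , r)

  Counted : Word k → Word k → Word k → Set
  Counted u v w = Unbordered w × IsPrefix u w × IsSuffix v w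

  counted? : ∀ u v w → Dec (Counted u v w)
  counted? u v w = unbordered? w ×-dec isPrefix? u w ×-dec isSuffix? v w

G : (k : ℕ) → Word k → Word k → ℕ → ℕ
G k u v m = length (filter (counted? u v) (words k m))

-- Σ_{i=a}^{b} f i  (empty, i.e. 0, when b < a)
sumFromTo : ℕ → ℕ → (ℕ → ℕ) → ℕ
sumFromTo a b f = sum (map f (applyUpTo (a +_) (suc b ∸ a)))

-- A word w of length n with prefix u and suffix v is either unbordered, or its shortest
-- border x is unbordered, so 2|x| ≤ n, and w = x y x.  Since (u, v) is mutually unbordered
-- and u ≠ v, no word shorter than 2t has prefix u and suffix v, and every border of w has
-- length at least 2t; hence x itself has prefix u and suffix v, i.e. x is counted by
-- G_{u,v}(|x|), while y is arbitrary.  A word has at most one unbordered border, so this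
-- splits the k^(n-2t) words with prefix u and suffix v into disjoint classes of sizes
-- G_{u,v}(n) and G_{u,v}(i) k^(n-2i) for 2t ≤ i ≤ n/2.

module Submission where

open import Defs
open import Data.Nat using (ℕ; zero; suc; _+_; _*_; _∸_; _^_; _≤_; _<_; _≥_; z≤n; s≤s; _≤?_)
open import Data.Nat.Properties
open import Data.Nat.DivMod using (_/_; m*n/n≡m; /-monoˡ-≤; m/n*n≤m)
open import Data.Nat.Induction using (<-wellFounded)
open import Data.Nat.ListAction using (sum)
open import Data.Fin as Fin using (Fin)
import Data.Fin.Properties as Finₚ
open import Data.List using (List; []; _∷_; _++_; length; take; drop; filter; map; concatMap; allFin; applyUpTo; tabulate)
open import Data.List.Properties
  using (∷-injectiveˡ; ∷-injectiveʳ; ≡-dec; length-++; length-take; length-drop; take++drop≡id;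
         ++-assoc; ++-identityʳ; filter-++; filter-none; filter-accept; map-cong; map-cong-local; map-tabulate; length-tabulate)
open import Data.List.Membership.Propositional using (_∈_; lose)
open import Data.List.Membership.Propositional.Properties using (∈-applyUpTo⁺; ∈-applyUpTo⁻)
open import Data.List.Relation.Unary.All as All using (All; []; _∷_)
open import Data.List.Relation.Unary.All.Properties using (map⁺; concat⁺; All¬⇒¬Any)
open import Data.List.Relation.Unary.Any as Any using (Any; any?)
open import Data.List.Relation.Unary.AllPairs using ([]; _∷_)
open import Data.List.Relation.Unary.Unique.Propositional using (Unique)
open import Data.List.Relation.Unary.Unique.Propositional.Properties using (applyUpTo⁺₁)
open import Data.Product using (∃-syntax; _×_; _,_; proj₁; proj₂)
open import Data.Sum using (_⊎_; inj₁; inj₂)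
open import Data.Unit using (⊤; tt)
open import Induction.WellFounded using (Acc; acc)
open import Relation.Nullary using (¬_; Dec; yes; no; contradiction)
open import Relation.Nullary.Decidable using (_×-dec_; _⊎-dec_)
open import Relation.Unary using (Decidable)
open import Function using (_∘_; id)
open import Relation.Binary.PropositionalEquality
open import Relation.Binary.Definitions using (tri<; tri≈; tri>)

-- Lists, sums and arithmetic

module _ {A : Set} where

  ++-equidivisible : (p q r s : List A) → p ++ q ≡ r ++ s → length p ≤ length r →
                     ∃[ z ] (r ≡ p ++ z × q ≡ z ++ s)
  ++-equidivisible []      q r       s eq _ = r , refl , eq
  ++-equidivisible (x ∷ p) q (y ∷ r) s eq (s≤s p≤r)
    with refl ← ∷-injectiveˡ eq
       | z , refl , q≡z++s ← ++-equidivisible p q r s (∷-injectiveʳ eq) p≤r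
    = z , refl , q≡z++s

  ++-≤-length : ∀ {p q r s : List A} → p ++ q ≡ r ++ s → length s ≤ length q → length p ≤ length r
  ++-≤-length {p} {q} {r} {s} eq |s|≤|q| = +-cancelʳ-≤ (length q) (length p) (length r) (begin
    length p + length q  ≡⟨ length-++ p ⟨
    length (p ++ q)      ≡⟨ cong length eq ⟩
    length (r ++ s)      ≡⟨ length-++ r ⟩
    length r + length s  ≤⟨ +-monoʳ-≤ (length r) |s|≤|q| ⟩
    length r + length q  ∎)
    where open ≤-Reasoning

  take-length-++ : (p q : List A) → take (length p) (p ++ q) ≡ p
  take-length-++ []      q = refl
  take-length-++ (x ∷ p) q = cong (x ∷_) (take-length-++ p q)

  drop-length-++ : (p q : List A) → drop (length p) (p ++ q) ≡ q
  drop-length-++ []      q = refl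
  drop-length-++ (x ∷ p) q = drop-length-++ p q

  length-filter-map : ∀ {B : Set} {P : B → Set} (P? : Decidable P) (f : A → B) xs →
                      length (filter P? (map f xs)) ≡ length (filter (λ x → P? (f x)) xs)
  length-filter-map P? f []       = refl
  length-filter-map P? f (x ∷ xs) with P? (f x)
  ... | yes _ = cong suc (length-filter-map P? f xs)
  ... | no  _ = length-filter-map P? f xs

  module _ {P Q : A → Set} (P? : Decidable P) (Q? : Decidable Q) where

    filter-cong-local : ∀ {xs} → All (λ x → P x → Q x) xs → All (λ x → Q x → P x) xs →
                        filter P? xs ≡ filter Q? xs
    filter-cong-local {[]}     []         []         = refl
    filter-cong-local {x ∷ xs} (pq ∷ pqs) (qp ∷ qps) with P? x | Q? x
    ... | yes _  | yes _  = cong (x ∷_) (filter-cong-local pqs qps)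
    ... | no  _  | no  _  = filter-cong-local pqs qps
    ... | yes px | no ¬qx = contradiction (pq px) ¬qx
    ... | no ¬px | yes qx = contradiction (qp qx) ¬px

    length-filter-⊎ : ∀ {xs} → All (λ x → P x → ¬ Q x) xs →
                      length (filter (λ x → P? x ⊎-dec Q? x) xs) ≡ length (filter P? xs) + length (filter Q? xs)
    length-filter-⊎ {[]}     []           = refl
    length-filter-⊎ {x ∷ xs} (p⇒¬q ∷ dis) with P? x | Q? x
    ... | yes px | yes qx = contradiction qx (p⇒¬q px)
    ... | yes _  | no  _  = cong suc (length-filter-⊎ dis)
    ... | no  _  | yes _  = trans (cong suc (length-filter-⊎ dis)) (sym (+-suc _ _))
    ... | no  _  | no  _  = length-filter-⊎ dis

  length-filter-any : ∀ {I : Set} {P : I → A → Set} (P? : ∀ i → Decidable (P i)) {is xs} → Unique is →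
                      All (λ x → ∀ {i j} → P i x → P j x → i ≡ j) xs →
                      length (filter (λ x → any? (λ i → P? i x) is) xs) ≡ sum (map (λ i → length (filter (P? i) xs)) is)
  length-filter-any         P? {[]}     {xs} []              _          = cong length (filter-none _ (All.universal (λ _ ()) xs))
  length-filter-any {P = P} P? {i ∷ is} {xs} (i∉is ∷ unique) functional = begin
    length (filter (λ x → any? (λ j → P? j x) (i ∷ is)) xs)
      ≡⟨ cong length (filter-cong-local _ _ (All.universal (λ _ → Any.toSum) xs) (All.universal (λ _ → Any.fromSum) xs)) ⟩
    length (filter (λ x → P? i x ⊎-dec any? (λ j → P? j x) is) xs)
      ≡⟨ length-filter-⊎ (P? i) _ (All.map disjoint functional) ⟩
    length (filter (P? i) xs) + length (filter (λ x → any? (λ j → P? j x) is) xs)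
      ≡⟨ cong (length (filter (P? i) xs) +_) (length-filter-any P? unique functional) ⟩
    length (filter (P? i) xs) + sum (map (λ j → length (filter (P? j) xs)) is) ∎
    where
      open ≡-Reasoning
      disjoint : ∀ {x} → (∀ {j j′} → P j x → P j′ x → j ≡ j′) → P i x → ¬ Any (λ j → P j x) is
      disjoint P-functional Pix = All¬⇒¬Any (All.map (λ i≢j Pjx → i≢j (P-functional Pix Pjx)) i∉is)

  positive⇒nonEmpty : ∀ {z : List A} → 0 < length z → z ≢ []
  positive⇒nonEmpty {_ ∷ _} _ ()

sum-map-const : ∀ {A : Set} c (xs : List A) → sum (map (λ _ → c) xs) ≡ length xs * c
sum-map-const c []       = refl
sum-map-const c (x ∷ xs) = cong (c +_) (sum-map-const c xs)

sum-map-*ʳ : ∀ {A : Set} (f : A → ℕ) c xs → sum (map (λ x → f x * c) xs) ≡ sum (map f xs) * c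
sum-map-*ʳ f c []       = refl
sum-map-*ʳ f c (x ∷ xs) = trans (cong (f x * c +_) (sum-map-*ʳ f c xs)) (sym (*-distribʳ-+ c (f x) _))

sum-tabulate-zero : ∀ {n} (f : Fin n → ℕ) → (∀ d → f d ≡ 0) → sum (tabulate f) ≡ 0
sum-tabulate-zero {zero}  f f≡0 = refl
sum-tabulate-zero {suc n} f f≡0 = cong₂ _+_ (f≡0 Fin.zero) (sum-tabulate-zero (λ d → f (Fin.suc d)) (λ d → f≡0 (Fin.suc d)))

sum-tabulate-single : ∀ {n} (f : Fin n → ℕ) c → (∀ d → d ≢ c → f d ≡ 0) → sum (tabulate f) ≡ f c
sum-tabulate-single {suc n} f Fin.zero    f≡0 =
  trans (cong (f Fin.zero +_) (sum-tabulate-zero _ (λ d → f≡0 (Fin.suc d) λ ()))) (+-identityʳ _)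
sum-tabulate-single {suc n} f (Fin.suc c) f≡0 =
  cong₂ _+_ (f≡0 Fin.zero λ ()) (sum-tabulate-single _ c (λ d d≢c → f≡0 (Fin.suc d) (d≢c ∘ Finₚ.suc-injective)))

2*m≡m+m : ∀ m → 2 * m ≡ m + m
2*m≡m+m m = cong (m +_) (+-identityʳ m)

m∸n≡[m∸2n]+n : ∀ {m n} → 2 * n ≤ m → m ∸ n ≡ (m ∸ 2 * n) + n
m∸n≡[m∸2n]+n {m} {n} 2n≤m = begin
  m ∸ n              ≡⟨ m∸n+n≡m (m+n≤o⇒m≤o∸n n n+n≤m) ⟨
  (m ∸ n ∸ n) + n    ≡⟨ cong (_+ n) (∸-+-assoc m n n) ⟩
  (m ∸ (n + n)) + n  ≡⟨ cong (λ j → (m ∸ j) + n) (2*m≡m+m n) ⟨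
  (m ∸ 2 * n) + n    ∎
  where
    open ≡-Reasoning
    n+n≤m = subst (_≤ m) (2*m≡m+m n) 2n≤m

2*m≤n⇒m≤n/2 : ∀ {m n} → 2 * m ≤ n → m ≤ n / 2
2*m≤n⇒m≤n/2 {m} {n} 2m≤n = subst (_≤ n / 2) (m*n/n≡m m 2) (/-monoˡ-≤ 2 (subst (_≤ n) (*-comm 2 m) 2m≤n))

m≤n/2⇒2*m≤n : ∀ {m n} → m ≤ n / 2 → 2 * m ≤ n
m≤n/2⇒2*m≤n {m} {n} m≤n/2 = ≤-trans (*-monoʳ-≤ 2 m≤n/2) (subst (_≤ n) (*-comm (n / 2) 2) (m/n*n≤m n 2))

-- Prefixes, suffixes and borders

module _ {k : ℕ} where

  prefix-length : ∀ {p w : Word k} → IsPrefix p w → length p ≤ length w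
  prefix-length {p} (s , refl) = subst (length p ≤_) (sym (length-++ p)) (m≤m+n _ _)

  suffix-length : ∀ {s w : Word k} → IsSuffix s w → length s ≤ length w
  suffix-length {s} (p , refl) = subst (length s ≤_) (sym (length-++ p)) (m≤n+m _ _)

  prefix⇒take : ∀ {p w : Word k} → IsPrefix p w → take (length p) w ≡ p
  prefix⇒take {p} (s , refl) = take-length-++ p s

  take-prefix : ∀ i (w : Word k) → IsPrefix (take i w) w
  take-prefix i w = drop i w , take++drop≡id i w

  drop-suffix : ∀ i (w : Word k) → IsSuffix (drop i w) w
  drop-suffix i w = take i w , take++drop≡id i w

  suffix⇒drop : ∀ {s w : Word k} m → IsSuffix s w → length w ≡ m + length s → drop m w ≡ s
  suffix⇒drop {s} m (p , refl) |w|≡m+|s| =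
    subst (λ i → drop i (p ++ s) ≡ s) |p|≡m (drop-length-++ p s)
    where |p|≡m = +-cancelʳ-≡ (length s) (length p) m (trans (sym (length-++ p)) |w|≡m+|s|)

  prefix-unique : ∀ {p q w : Word k} → IsPrefix p w → IsPrefix q w → length p ≡ length q → p ≡ q
  prefix-unique {p} {q} {w} p≤w q≤w |p|≡|q| = begin
    p                    ≡⟨ prefix⇒take p≤w ⟨
    take (length p) w    ≡⟨ cong (λ i → take i w) |p|≡|q| ⟩
    take (length q) w    ≡⟨ prefix⇒take q≤w ⟩
    q                    ∎
    where open ≡-Reasoning

  prefix-trans : ∀ {p q w : Word k} → IsPrefix p q → IsPrefix q w → IsPrefix p w
  prefix-trans {p} (s , refl) (s′ , refl) = s ++ s′ , sym (++-assoc p s s′)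

  suffix-trans : ∀ {s q w : Word k} → IsSuffix s q → IsSuffix q w → IsSuffix s w
  suffix-trans {s} (p , refl) (p′ , refl) = p′ ++ p , ++-assoc p′ p s

  prefix-of-prefix : ∀ {p q w : Word k} → IsPrefix p w → IsPrefix q w → length p ≤ length q → IsPrefix p q
  prefix-of-prefix {p} {q} (s , refl) (s′ , q++s′≡p++s) |p|≤|q|
    with z , q≡p++z , _ ← ++-equidivisible p s q s′ (sym q++s′≡p++s) |p|≤|q|
    = z , sym q≡p++z

  suffix-of-suffix : ∀ {s q w : Word k} → IsSuffix s w → IsSuffix q w → length s ≤ length q → IsSuffix s q
  suffix-of-suffix {s} {q} (p , refl) (p′ , p′++q≡p++s) |s|≤|q|
    with z , _ , q≡z++s ← ++-equidivisible p′ q p s p′++q≡p++s (++-≤-length {p = p′} {r = p} p′++q≡p++s |s|≤|q|)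
    = z , sym q≡z++s

  suffix-of-drop : ∀ {s w : Word k} i → IsSuffix s w → length s + i ≤ length w → IsSuffix s (drop i w)
  suffix-of-drop {s} {w} i s-suffix |s|+i≤|w| =
    suffix-of-suffix s-suffix (drop-suffix i w)
      (subst (length s ≤_) (sym (length-drop i w)) (m+n≤o⇒m≤o∸n (length s) |s|+i≤|w|))

  border-trans : ∀ {c b w : Word k} → Border c b → Border b w → Border c w
  border-trans (c≢[] , (c≤b , c<b) , (c≤b′ , c<b′)) (_ , (b≤w , b<w) , (b≤w′ , b<w′)) =
    c≢[] , (prefix-trans c≤b b≤w , <-trans c<b b<w) , (suffix-trans c≤b′ b≤w′ , <-trans c<b′ b<w′)

  border-of-border : ∀ {b c w : Word k} → Border b w → Border c w → length b < length c → Border b c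
  border-of-border (b≢[] , (b≤w , _) , (b≤w′ , _)) (_ , (c≤w , _) , (c≤w′ , _)) b<c =
    b≢[] , (prefix-of-prefix b≤w c≤w (<⇒≤ b<c) , b<c) , (suffix-of-suffix b≤w′ c≤w′ (<⇒≤ b<c) , b<c)

  shortest-border-unbordered : ∀ {b w : Word k} → Border b w → ∃[ c ] (Border c w × Unbordered c)
  shortest-border-unbordered {b} = go (<-wellFounded (length b))
    where
      go : ∀ {b w} → Acc _<_ (length b) → Border b w → ∃[ c ] (Border c w × Unbordered c)
      go {b} (acc rec) b-border with bordered? b
      ... | yes (c , c-border) = go (rec (proj₂ (proj₁ (proj₂ c-border)))) (border-trans c-border b-border)
      ... | no  unbordered     = b , b-border , λ c c-border → unbordered (c , c-border)

  unbordered-border-unique : ∀ {b c w : Word k} → Border b w → Unbordered b → Border c w → Unbordered c → b ≡ c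
  unbordered-border-unique {b} {c} b-border b-unbordered c-border c-unbordered with <-cmp (length b) (length c)
  ... | tri< b<c _ _ = contradiction (border-of-border b-border c-border b<c) (c-unbordered _)
  ... | tri≈ _ |b|≡|c| _ = prefix-unique (proj₁ (proj₁ (proj₂ b-border))) (proj₁ (proj₁ (proj₂ c-border))) |b|≡|c|
  ... | tri> _ _ c<b = contradiction (border-of-border c-border b-border c<b) (b-unbordered _)

  overlap⇒rightBorder : ∀ {u v x y : Word k} → length u ≡ length v → y ++ v ≡ u ++ x →
                         0 < length y → length y < length u → ∃[ z ] RightBorder z u v
  overlap⇒rightBorder {x = x} {y} |u|≡|v| eq 0<|y| |y|<|u|
    with z , refl , refl ← ++-equidivisible y _ _ x eq (<⇒≤ |y|<|u|)
    = z , z≢[] , ((y , refl) , |z|<|u|) , ((x , refl) , subst (length z <_) |u|≡|v| |z|<|u|)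
    where
      |z|<|u| : length z < length (y ++ z)
      |z|<|u| = subst (length z <_) (sym (length-++ y)) (m<n+m (length z) 0<|y|)
      z≢[] : z ≢ []
      z≢[] refl = <-irrefl (sym (cong length (++-identityʳ y))) |y|<|u|

  -- If the two occurrences of b in w overlapped, the overlap would be a border of b.
  unbordered-border-short : ∀ {b w : Word k} → Unbordered b → Border b w → 2 * length b ≤ length w
  unbordered-border-short {b} {w} b-unbordered (_ , ((x , b++x≡w) , _) , ((y , y++b≡w) , b<w))
    with 2 * length b ≤? length w
  ... | yes short = short
  ... | no  long =
    let z , z≢[] , z-suffix , z-prefix = overlap⇒rightBorder refl (trans y++b≡w (sym b++x≡w)) 0<|y| |y|<|b|
    in  contradiction (z≢[] , z-prefix , z-suffix) (b-unbordered z)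
    where
      |w|≡|y|+|b| : length w ≡ length y + length b
      |w|≡|y|+|b| = trans (cong length (sym y++b≡w)) (length-++ y)
      0<|y| : 0 < length y
      0<|y| = +-cancelʳ-< (length b) 0 (length y) (subst (length b <_) |w|≡|y|+|b| b<w)
      |y|<|b| : length y < length b
      |y|<|b| = +-cancelʳ-< (length b) (length y) (length b)
                  (subst₂ _<_ |w|≡|y|+|b| (2*m≡m+m (length b)) (≰⇒> long))

  short-border⇒suffix-of-rest : ∀ {b w : Word k} → IsPrefix b w → IsSuffix b w → 2 * length b ≤ length w →
                                IsSuffix b (drop (length b) w)
  short-border⇒suffix-of-rest {b} (x , refl) (y , y++b≡b++x) short =
    let z , _ , x≡z++b = ++-equidivisible b x y b (sym y++b≡b++x) |b|≤|y|
    in  z , trans (sym x≡z++b) (sym (drop-length-++ b x))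
    where
      |b|≤|y| : length b ≤ length y
      |b|≤|y| = +-cancelʳ-≤ (length b) (length b) (length y) (begin
        length b + length b  ≡⟨ 2*m≡m+m (length b) ⟨
        2 * length b         ≤⟨ short ⟩
        length (b ++ x)      ≡⟨ cong length y++b≡b++x ⟨
        length (y ++ b)      ≡⟨ length-++ y ⟩
        length y + length b  ∎)
        where open ≤-Reasoning

-- Counting words

module _ {k : ℕ} where

  infix 4 _≟ʷ_
  _≟ʷ_ : (x y : Word k) → Dec (x ≡ y)
  _≟ʷ_ = ≡-dec Finₚ._≟_

  -- Opaque, so that m and P? can be recovered from count m P? by unification.
  opaque
    count : (m : ℕ) {P : Word k → Set} → Decidable P → ℕ
    count m P? = length (filter P? (words k m))

  words-length : ∀ m → All (λ w → length w ≡ m) (words k m)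
  words-length zero    = refl ∷ []
  words-length (suc m) =
    concat⁺ (map⁺ (All.universal (λ _ → map⁺ (All.map (cong suc) (words-length m))) (allFin k)))

  on-words : ∀ {m} {R : Word k → Set} → (∀ w → length w ≡ m → R w) → All R (words k m)
  on-words {m} R = All.map (λ {w} → R w) (words-length m)

  opaque
    unfolding count

    count-cong : ∀ {m} {P Q : Word k → Set} (P? : Decidable P) (Q? : Decidable Q) →
                 (∀ w → length w ≡ m → P w → Q w) → (∀ w → length w ≡ m → Q w → P w) → count m P? ≡ count m Q?
    count-cong P? Q? P⇒Q Q⇒P = cong length (filter-cong-local P? Q? (on-words P⇒Q) (on-words Q⇒P))

    count-⊎ : ∀ {m} {P Q : Word k → Set} (P? : Decidable P) (Q? : Decidable Q) →
              (∀ w → length w ≡ m → P w → ¬ Q w) → count m (λ w → P? w ⊎-dec Q? w) ≡ count m P? + count m Q?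
    count-⊎ P? Q? disjoint = length-filter-⊎ P? Q? (on-words disjoint)

    count-none : ∀ {m} {P : Word k → Set} (P? : Decidable P) → (∀ w → length w ≡ m → ¬ P w) → count m P? ≡ 0
    count-none P? none = cong length (filter-none P? (on-words none))

    count-any : ∀ {m} {I : Set} {P : I → Word k → Set} (P? : ∀ i → Decidable (P i)) {is} → Unique is →
                (∀ w → length w ≡ m → ∀ {i j} → P i w → P j w → i ≡ j) →
                count m (λ w → any? (λ i → P? i w) is) ≡ sum (map (λ i → count m (P? i)) is)
    count-any P? unique functional = length-filter-any P? unique (on-words (λ w |w| → functional w |w|))

    G≡count : ∀ {u v : Word k} m → G k u v m ≡ count m (counted? u v)
    G≡count m = refl

    count-[] : ∀ {P : Word k → Set} (P? : Decidable P) → P [] → count 0 P? ≡ 1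
    count-[] P? p = cong length (filter-accept P? p)

    count-suc : ∀ m {P : Word k → Set} (P? : Decidable P) →
                count (suc m) P? ≡ sum (map (λ a → count m (λ w → P? (a ∷ w))) (allFin k))
    count-suc m P? = go (allFin k)
      where
        go : ∀ as → length (filter P? (concatMap (λ a → map (a ∷_) (words k m)) as)) ≡
                    sum (map (λ a → count m (λ w → P? (a ∷ w))) as)
        go []       = refl
        go (a ∷ as) = trans (cong length (filter-++ P? (map (a ∷_) (words k m)) _))
                      (trans (length-++ (filter P? (map (a ∷_) (words k m))))
                             (cong₂ _+_ (length-filter-map P? (a ∷_) (words k m)) (go as)))

  count-all : ∀ m → count m (λ _ → yes tt) ≡ k ^ m
  count-all zero    = count-[] _ tt
  count-all (suc m) = begin
    count (suc m) (λ _ → yes tt)                            ≡⟨ count-suc m _ ⟩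
    sum (map (λ _ → count m (λ _ → yes tt)) (allFin k))     ≡⟨ cong sum (map-cong (λ _ → count-all m) (allFin k)) ⟩
    sum (map (λ _ → k ^ m) (allFin k))                      ≡⟨ sum-map-const (k ^ m) (allFin k) ⟩
    length (allFin k) * k ^ m                               ≡⟨ cong (_* k ^ m) (length-tabulate {n = k} id) ⟩
    k * k ^ m                                               ∎
    where open ≡-Reasoning

  count-≡ : ∀ x → count (length x) (_≟ʷ x) ≡ 1
  count-≡ []      = count-[] _ refl
  count-≡ (c ∷ x) = begin
    count (suc (length x)) (_≟ʷ c ∷ x)
      ≡⟨ count-suc (length x) _ ⟩
    sum (map (λ a → count (length x) (λ w → a ∷ w ≟ʷ c ∷ x)) (allFin k))
      ≡⟨ cong sum (map-tabulate {n = k} id _) ⟩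
    sum (tabulate (λ a → count (length x) (λ w → a ∷ w ≟ʷ c ∷ x)))
      ≡⟨ sum-tabulate-single _ c other-letters ⟩
    count (length x) (λ w → c ∷ w ≟ʷ c ∷ x)
      ≡⟨ count-cong _ _ (λ _ _ → ∷-injectiveʳ) (λ _ _ → cong (c ∷_)) ⟩
    count (length x) (_≟ʷ x)
      ≡⟨ count-≡ x ⟩
    1 ∎
    where
      open ≡-Reasoning
      other-letters : ∀ d → d ≢ c → count (length x) (λ w → d ∷ w ≟ʷ c ∷ x) ≡ 0
      other-letters d d≢c = count-none _ (λ _ _ → d≢c ∘ ∷-injectiveˡ)

  count-++ : ∀ a b c {Q : Word k → Set} {R : Word k → Word k → Set} (Q? : Decidable Q) (R? : ∀ x → Decidable (R x)) →
             (∀ x → length x ≡ a → Q x → count b (R? x) ≡ c) →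
             count (a + b) (λ w → Q? (take a w) ×-dec R? (take a w) (drop a w)) ≡ count a Q? * c
  count-++ zero b c Q? R? fiber with Q? []
  ... | yes q  = begin
    count b (λ w → yes q ×-dec R? [] w)  ≡⟨ count-cong _ (R? []) (λ _ _ → proj₂) (λ _ _ r → q , r) ⟩
    count b (R? [])                     ≡⟨ fiber [] refl q ⟩
    c                                   ≡⟨ +-identityʳ c ⟨
    1 * c                               ≡⟨ cong (_* c) (count-[] Q? q) ⟨
    count 0 Q? * c                      ∎
    where open ≡-Reasoning
  ... | no  ¬q = trans (count-none _ (λ _ _ → ¬q ∘ proj₁))
                       (cong (_* c) (sym (count-none Q? (λ { [] _ → ¬q }))))
  count-++ (suc a) b c Q? R? fiber = begin
    count (suc a + b) _                                         ≡⟨ count-suc (a + b) _ ⟩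
    sum (map (λ d → count (a + b) (λ w → Q? (d ∷ take a w) ×-dec R? (d ∷ take a w) (drop a w))) (allFin k))
      ≡⟨ cong sum (map-cong (λ d → count-++ a b c (λ x → Q? (d ∷ x)) (λ x → R? (d ∷ x))
                                     (λ x |x|≡a → fiber (d ∷ x) (cong suc |x|≡a))) (allFin k)) ⟩
    sum (map (λ d → count a (λ x → Q? (d ∷ x)) * c) (allFin k)) ≡⟨ sum-map-*ʳ _ c (allFin k) ⟩
    sum (map (λ d → count a (λ x → Q? (d ∷ x))) (allFin k)) * c ≡⟨ cong (_* c) (count-suc a Q?) ⟨
    count (suc a) Q? * c                                        ∎
    where open ≡-Reasoning

  count-suffix : ∀ m (x : Word k) → count (m + length x) (isSuffix? x) ≡ k ^ m
  count-suffix m x = begin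
    count (m + length x) (isSuffix? x)                       ≡⟨ count-cong _ _ split join ⟩
    count (m + length x) (λ w → (λ _ → yes tt) (take m w) ×-dec (drop m w ≟ʷ x))
      ≡⟨ count-++ m (length x) 1 _ (λ _ y → y ≟ʷ x) (λ _ _ _ → count-≡ x) ⟩
    count m (λ _ → yes tt) * 1                               ≡⟨ *-identityʳ _ ⟩
    count m (λ _ → yes tt)                                   ≡⟨ count-all m ⟩
    k ^ m                                                    ∎
    where
      open ≡-Reasoning
      split : ∀ w → length w ≡ m + length x → IsSuffix x w → ⊤ × drop m w ≡ x
      split w |w|≡m+|x| x-suffix = tt , suffix⇒drop m x-suffix |w|≡m+|x|
      join : ∀ w → length w ≡ m + length x → ⊤ × drop m w ≡ x → IsSuffix x w
      join w _ (_ , drop≡x) = subst (λ y → IsSuffix y w) drop≡x (drop-suffix m w)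

  count-take-suffix : ∀ {a} n {Q : Word k → Set} (Q? : Decidable Q) (s : Word k → Word k) → 2 * a ≤ n →
                      (∀ x → length x ≡ a → Q x → length (s x) ≡ a) →
                      count n (λ w → Q? (take a w) ×-dec isSuffix? (s (take a w)) (drop a w)) ≡ count a Q? * k ^ (n ∸ 2 * a)
  count-take-suffix {a} n {Q} Q? s 2a≤n |s| = begin
    count n _                     ≡⟨ cong (λ m → count m _) (m+[n∸m]≡n a≤n) ⟨
    count (a + (n ∸ a)) _         ≡⟨ count-++ a (n ∸ a) _ Q? (λ x → isSuffix? (s x)) fiber ⟩
    count a Q? * k ^ (n ∸ 2 * a)  ∎
    where
      open ≡-Reasoning
      a≤n : a ≤ n
      a≤n = m+n≤o⇒m≤o a (subst (_≤ n) (2*m≡m+m a) 2a≤n)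
      fiber : ∀ x → length x ≡ a → Q x → count (n ∸ a) (isSuffix? (s x)) ≡ k ^ (n ∸ 2 * a)
      fiber x |x|≡a q = begin
        count (n ∸ a) (isSuffix? (s x))
          ≡⟨ cong (λ m → count m (isSuffix? (s x))) (m∸n≡[m∸2n]+n {n} {a} 2a≤n) ⟩
        count (n ∸ 2 * a + a) (isSuffix? (s x))
          ≡⟨ cong (λ m → count (n ∸ 2 * a + m) (isSuffix? (s x))) (|s| x |x|≡a q) ⟨
        count (n ∸ 2 * a + length (s x)) (isSuffix? (s x))
          ≡⟨ count-suffix (n ∸ 2 * a) (s x) ⟩
        k ^ (n ∸ 2 * a) ∎

  count-prefix-suffix : ∀ {t n} {u v : Word k} → length u ≡ t → length v ≡ t → 2 * t ≤ n →
                        count n (λ w → isPrefix? u w ×-dec isSuffix? v w) ≡ k ^ (n ∸ 2 * t)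
  count-prefix-suffix {t} {n} {u} {v} |u|≡t |v|≡t 2t≤n = begin
    count n (λ w → isPrefix? u w ×-dec isSuffix? v w)  ≡⟨ count-cong _ _ split join ⟩
    count n (λ w → take t w ≟ʷ u ×-dec isSuffix? v (drop t w))
      ≡⟨ count-take-suffix n (_≟ʷ u) (λ _ → v) 2t≤n (λ _ _ _ → |v|≡t) ⟩
    count t (_≟ʷ u) * k ^ (n ∸ 2 * t)                 ≡⟨ cong (λ m → count m (_≟ʷ u) * k ^ (n ∸ 2 * t)) |u|≡t ⟨
    count (length u) (_≟ʷ u) * k ^ (n ∸ 2 * t)        ≡⟨ cong (_* k ^ (n ∸ 2 * t)) (count-≡ u) ⟩
    1 * k ^ (n ∸ 2 * t)                               ≡⟨ *-identityˡ _ ⟩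
    k ^ (n ∸ 2 * t)                                   ∎
    where
      open ≡-Reasoning
      split : ∀ w → length w ≡ n → IsPrefix u w × IsSuffix v w → take t w ≡ u × IsSuffix v (drop t w)
      split w |w|≡n (u-prefix , v-suffix) =
        subst (λ i → take i w ≡ u) |u|≡t (prefix⇒take u-prefix) ,
        suffix-of-drop t v-suffix (subst₂ _≤_ (trans (2*m≡m+m t) (cong (_+ t) (sym |v|≡t))) (sym |w|≡n) 2t≤n)
      join : ∀ w → length w ≡ n → take t w ≡ u × IsSuffix v (drop t w) → IsPrefix u w × IsSuffix v w
      join w _ (take≡u , v-suffix) = subst (λ p → IsPrefix p w) take≡u (take-prefix t w) , suffix-trans v-suffix (drop-suffix t w)

-- sumFromTo a b f reduces to sum (map f (range a b)).
range : ℕ → ℕ → List ℕ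
range a b = applyUpTo (a +_) (suc b ∸ a)

range-unique : ∀ a b → Unique (range a b)
range-unique a b = applyUpTo⁺₁ (a +_) _ (λ i<j _ → <⇒≢ (+-monoʳ-< a i<j))

∈-range⁺ : ∀ {a b i} → a ≤ i → i ≤ b → i ∈ range a b
∈-range⁺ {a} {b} a≤i i≤b = subst (_∈ range a b) (m+[n∸m]≡n a≤i) (∈-applyUpTo⁺ (a +_) (∸-monoˡ-< (s≤s i≤b) a≤i))

∈-range⇒≤ : ∀ {a b i} → i ∈ range a b → i ≤ b
∈-range⇒≤ {a} {b} i∈range with j , j<len , refl ← ∈-applyUpTo⁻ (a +_) i∈range =
  subst (_≤ b) (+-comm j a) (≤-pred (m≤o∸n⇒m+n≤o (suc j) (<⇒≤ (m∸n≢0⇒n<m (m<n⇒n≢0 j<len))) j<len))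

-- Words framed by an unbordered border

module Framing {k t : ℕ} {u v : Word k} (|u|≡t : length u ≡ t) (|v|≡t : length v ≡ t) (1≤t : 1 ≤ t)
         (u≢v : u ≢ v) (mutually-unbordered : MutuallyUnbordered u v) where

  private
    |u|≡|v| : length u ≡ length v
    |u|≡|v| = trans |u|≡t (sym |v|≡t)

  -- Otherwise the occurrences of u and v in x coincide (u = v) or overlap in a right-border.
  prefix-suffix⇒2t≤length : ∀ {x} → IsPrefix u x → IsSuffix v x → 2 * t ≤ length x
  prefix-suffix⇒2t≤length {x} (p , u++p≡x) (y , y++v≡x) with 2 * t ≤? length x
  ... | yes long = long
  ... | no  short with y | y++v≡x
  ...   | []     | refl = contradiction (prefix-unique (p , u++p≡x) ([] , ++-identityʳ v) |u|≡|v|) u≢v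
  ...   | c ∷ y′ | c∷y′++v≡x =
    let z , z-border = overlap⇒rightBorder |u|≡|v| (trans c∷y′++v≡x (sym u++p≡x)) (s≤s z≤n) |y|<|u|
    in  contradiction z-border (proj₁ mutually-unbordered z)
    where
      |x|≡|y|+t : length x ≡ length (c ∷ y′) + t
      |x|≡|y|+t = trans (cong length (sym c∷y′++v≡x)) (trans (length-++ (c ∷ y′)) (cong (length (c ∷ y′) +_) |v|≡t))
      |y|<|u| : length (c ∷ y′) < length u
      |y|<|u| = subst (length (c ∷ y′) <_) (sym |u|≡t)
                  (+-cancelʳ-< t (length (c ∷ y′)) t (subst₂ _<_ |x|≡|y|+t (2*m≡m+m t) (≰⇒> short)))

  border-2t≤length : ∀ {b w} → IsPrefix u w → IsSuffix v w → Border b w → 2 * t ≤ length b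
  border-2t≤length {b} u-prefix v-suffix (b≢[] , (b-prefix , _) , (b-suffix , _)) with t ≤? length b
  ... | yes t≤|b| = prefix-suffix⇒2t≤length (prefix-of-prefix u-prefix b-prefix (subst (_≤ length b) (sym |u|≡t) t≤|b|))
                                            (suffix-of-suffix v-suffix b-suffix (subst (_≤ length b) (sym |v|≡t) t≤|b|))
  ... | no  t≰|b| = contradiction (b≢[] , (prefix-of-prefix b-prefix u-prefix (<⇒≤ |b|<|u|) , |b|<|u|) ,
                                          (suffix-of-suffix b-suffix v-suffix (<⇒≤ |b|<|v|) , |b|<|v|))
                                  (proj₂ mutually-unbordered b)
    where
      |b|<|u| = subst (length b <_) (sym |u|≡t) (≰⇒> t≰|b|)
      |b|<|v| = subst (length b <_) (sym |v|≡t) (≰⇒> t≰|b|)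

  -- Framed i w: w = x y x with |x| = i and x counted by G_{u,v}(i).
  Framed : ℕ → Word k → Set
  Framed i w = Counted u v (take i w) × IsSuffix (take i w) (drop i w)

  framed? : ∀ i → Decidable (Framed i)
  framed? i w = counted? u v (take i w) ×-dec isSuffix? (take i w) (drop i w)

  framed⇒border : ∀ {i w} → Framed i w → Border (take i w) w
  framed⇒border {i} {w} ((_ , u-prefix , _) , x-suffix) =
    positive⇒nonEmpty 0<|x| , (take-prefix i w , |x|<|w|) , (suffix-trans x-suffix (drop-suffix i w) , |x|<|w|)
    where
      0<|x| : 0 < length (take i w)
      0<|x| = ≤-trans 1≤t (subst (_≤ length (take i w)) |u|≡t (prefix-length u-prefix))
      |x|<|w| : length (take i w) < length w
      |x|<|w| = subst (length (take i w) <_) (trans (sym (length-++ (take i w))) (cong length (take++drop≡id i w)))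
                  (m<m+n (length (take i w)) (<-≤-trans 0<|x| (suffix-length x-suffix)))

  framed-index : ∀ {i w} → Framed i w → length (take i w) ≡ i
  framed-index {i} {w} framed with ≤-total i (length w)
  ... | inj₁ i≤|w| = trans (length-take i w) (m≤n⇒m⊓n≡m i≤|w|)
  ... | inj₂ |w|≤i = contradiction (trans (length-take i w) (m≥n⇒m⊓n≡n |w|≤i))
                                   (<⇒≢ (proj₂ (proj₁ (proj₂ (framed⇒border framed)))))

  framed-unique : ∀ {i j w} → Framed i w → Framed j w → i ≡ j
  framed-unique {i} {j} {w} i-framed j-framed = begin
    i                     ≡⟨ framed-index i-framed ⟨
    length (take i w)     ≡⟨ cong length (unbordered-border-unique (framed⇒border i-framed) (proj₁ (proj₁ i-framed))
                                                                   (framed⇒border j-framed) (proj₁ (proj₁ j-framed))) ⟩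
    length (take j w)     ≡⟨ framed-index j-framed ⟩
    j                     ∎
    where open ≡-Reasoning

  framed⇒prefix-suffix : ∀ {i w} → Framed i w → IsPrefix u w × IsSuffix v w
  framed⇒prefix-suffix {i} {w} framed@((_ , u-prefix , v-suffix) , _) =
    prefix-trans u-prefix (take-prefix i w) , suffix-trans v-suffix (proj₁ (proj₂ (proj₂ (framed⇒border framed))))

  unbordered-border⇒framed : ∀ {c w} → IsPrefix u w → IsSuffix v w → Border c w → Unbordered c → Framed (length c) w
  unbordered-border⇒framed {c} {w} u-prefix v-suffix c-border@(_ , (c-prefix , _) , (c-suffix , _)) c-unbordered
    rewrite prefix⇒take c-prefix =
      (c-unbordered , prefix-of-prefix u-prefix c-prefix (subst (_≤ length c) (sym |u|≡t) t≤|c|)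
                    , suffix-of-suffix v-suffix c-suffix (subst (_≤ length c) (sym |v|≡t) t≤|c|)) ,
      short-border⇒suffix-of-rest c-prefix c-suffix (unbordered-border-short c-unbordered c-border)
    where
      t≤|c| : t ≤ length c
      t≤|c| = m+n≤o⇒m≤o t (subst (_≤ length c) (2*m≡m+m t) (border-2t≤length u-prefix v-suffix c-border))

  prefix-suffix⇒counted⊎framed : ∀ {w} → IsPrefix u w → IsSuffix v w →
                                  Counted u v w ⊎ ∃[ i ] (2 * t ≤ i × 2 * i ≤ length w × Framed i w)
  prefix-suffix⇒counted⊎framed {w} u-prefix v-suffix with bordered? w
  ... | no  unbordered = inj₁ ((λ b b-border → unbordered (b , b-border)) , u-prefix , v-suffix)
  ... | yes (_ , b-border) with c , c-border , c-unbordered ← shortest-border-unbordered b-border =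
    inj₂ (length c , border-2t≤length u-prefix v-suffix c-border , unbordered-border-short c-unbordered c-border ,
          unbordered-border⇒framed u-prefix v-suffix c-border c-unbordered)

  count-framed : ∀ {n i} → 2 * i ≤ n → count n (framed? i) ≡ G k u v i * k ^ (n ∸ 2 * i)
  count-framed {n} {i} 2i≤n =
    trans (count-take-suffix n (counted? u v) id 2i≤n (λ _ |x|≡i _ → |x|≡i)) (cong (_* k ^ (n ∸ 2 * i)) (sym (G≡count i)))

  count-prefix-suffix-decomposition :
    ∀ n → count n (λ w → isPrefix? u w ×-dec isSuffix? v w) ≡
          G k u v n + sumFromTo (2 * t) (n / 2) (λ i → count n (framed? i))
  count-prefix-suffix-decomposition n = begin
    count n (λ w → isPrefix? u w ×-dec isSuffix? v w)          ≡⟨ count-cong _ _ split join ⟩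
    count n (λ w → counted? u v w ⊎-dec any? (λ i → framed? i w) (range (2 * t) (n / 2)))
                                                                ≡⟨ count-⊎ _ _ disjoint ⟩
    count n (counted? u v) + count n (λ w → any? (λ i → framed? i w) (range (2 * t) (n / 2)))
      ≡⟨ cong₂ _+_ (sym (G≡count n)) (count-any framed? (range-unique (2 * t) (n / 2)) (λ _ _ → framed-unique)) ⟩
    G k u v n + sumFromTo (2 * t) (n / 2) (λ i → count n (framed? i)) ∎
    where
      open ≡-Reasoning
      split : ∀ w → length w ≡ n → IsPrefix u w × IsSuffix v w →
              Counted u v w ⊎ Any (λ i → Framed i w) (range (2 * t) (n / 2))
      split w |w|≡n (u-prefix , v-suffix) with prefix-suffix⇒counted⊎framed u-prefix v-suffix
      ... | inj₁ counted = inj₁ counted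
      ... | inj₂ (i , 2t≤i , 2i≤|w| , framed) =
        inj₂ (lose (∈-range⁺ 2t≤i (2*m≤n⇒m≤n/2 (subst (2 * i ≤_) |w|≡n 2i≤|w|))) framed)
      join : ∀ w → length w ≡ n → Counted u v w ⊎ Any (λ i → Framed i w) (range (2 * t) (n / 2)) →
             IsPrefix u w × IsSuffix v w
      join w _ (inj₁ (_ , u-prefix , v-suffix)) = u-prefix , v-suffix
      join w _ (inj₂ some-framed) = framed⇒prefix-suffix (proj₂ (Any.satisfied some-framed))
      disjoint : ∀ w → length w ≡ n → Counted u v w → ¬ Any (λ i → Framed i w) (range (2 * t) (n / 2))
      disjoint w _ (w-unbordered , _) some-framed =
        let i , framed = Any.satisfied some-framed in w-unbordered (take i w) (framed⇒border framed)

lemma8 : (k n t : ℕ) → 1 ≤ k → t ≤ n → 1 ≤ t →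
         (u v : Word k) → length u ≡ t → length v ≡ t →
         u ≢ v → MutuallyUnbordered u v →
         (n < 2 * t → G k u v n ≡ 0) ×
         (n ≥ 2 * t → G k u v n + sumFromTo (2 * t) (n / 2) (λ i → G k u v i * k ^ (n ∸ 2 * i)) ≡ k ^ (n ∸ 2 * t))
lemma8 k n t _ _ 1≤t u v |u|≡t |v|≡t u≢v mutually-unbordered = too-short , recurrence
  where
    open Framing |u|≡t |v|≡t 1≤t u≢v mutually-unbordered

    too-short : n < 2 * t → G k u v n ≡ 0
    too-short n<2t = trans (G≡count n) (count-none _ λ w |w|≡n (_ , u-prefix , v-suffix) →
      <⇒≱ n<2t (subst (2 * t ≤_) |w|≡n (prefix-suffix⇒2t≤length u-prefix v-suffix)))

    recurrence : n ≥ 2 * t → G k u v n + sumFromTo (2 * t) (n / 2) (λ i → G k u v i * k ^ (n ∸ 2 * i)) ≡ k ^ (n ∸ 2 * t)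
    recurrence 2t≤n = begin
      G k u v n + sum (map (λ i → G k u v i * k ^ (n ∸ 2 * i)) (range (2 * t) (n / 2)))
        ≡⟨ cong (λ xs → G k u v n + sum xs) (map-cong-local (All.tabulate λ {i} i∈range →
             sym (count-framed {n} {i} (m≤n/2⇒2*m≤n (∈-range⇒≤ {2 * t} {n / 2} i∈range))))) ⟩
      G k u v n + sum (map (λ i → count n (framed? i)) (range (2 * t) (n / 2)))
        ≡⟨ count-prefix-suffix-decomposition n ⟨
      count n (λ w → isPrefix? u w ×-dec isSuffix? v w)
        ≡⟨ count-prefix-suffix |u|≡t |v|≡t 2t≤n ⟩
      k ^ (n ∸ 2 * t) ∎
      where open ≡-Reasoning
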